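{- Let $\zeta>0$, let $(G,\sigma)$ be an edge-ordered graph with a phase-partition counter $\phi$, and let $\widehat{\epsilon}=\widehat{\epsilon}_\zeta$ be the associated error function. Then for every vertex $v$ and every phase $r\ge 0$, \[\widehat{\epsilon}^{\;r}(v)\le \zeta\sum_{P\in\mathcal{P}^r(v)}\left(\frac{5}{\Delta\epsilon^2}\right)^{l(P)},\] where $l(P)$ is the length (number of edges) of $P$.
   Context: Fix $\epsilon\in(0,1)$ and $\Delta$. An edge-ordered graph $(G,\sigma)$ is a graph $G$ of maximum degree $\Delta$ together with a one-to-one map $\sigma:E(G)\to[m]$; $e_i=\sigma^{ -1}(i)$ is the edge at step $i$ (a null edge, incident to no vertex, if undefined). For a vertex $v$, $T(v)$ is the set of steps $i$ with $v\in e_i$; for $j\in T(v)$, $e_j-v$ denotes the other endpoint of $e_j$. A phase-partition counter assigns to each vertex $v$ and step $i$ a nonnegative integer $\phi_i(v)$, nondecreasing in $i$ with increments of at most $1$; the $r$-th $v$-phase is $\{i:\phi_i(v)=r\}$, $T^r(v)=\{i\in T(v):\phi_i(v)=r\}$, $T^{\le r}(v)=\bigcup_{r'\le r}T^{r'}(v)$, and $\phi_i(v)\ge1$ for $i\in T(v)$. For $j\in T(v)$ let $s_j(v)=\phi_j(e_j-v)$. The error function is defined by $\widehat{\epsilon}^{\;0}(v)=0$ and $\widehat{\epsilon}^{\;r}(v)=\zeta+\frac{5}{\Delta\epsilon^2}\sum_{j\in T^{\le r}(v)}\widehat{\epsilon}^{\;s_j(v)-1}(e_j-v)$ for $r\ge1$.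 $\mathcal{P}^r(v)$ is the set of valid paths from $v$: sequences of edges $(e_{i_1},\dots,e_{i_t})$, $t\ge0$, with vertices $x_0=v,x_1,\dots,x_t$ such that $e_{i_k}=(x_{k-1},x_k)$, $i_1\in T^{\le r}(v)$, and $\phi_{i_{k+1}}(x_k)<\phi_{i_k}(x_k)$ for all $1\le k<t$ (the empty path, $t=0$, is included).
   Formalization: The parameters $\epsilon\in(0,1)$ and $\zeta>0$ are rational, so the constant $\frac{5}{\Delta\epsilon^2}$ and the values of the error function are rational too. -}

module Defs where

open import Data.Nat as ℕ using (ℕ; zero; suc; _∸_; _≤ᵇ_)
open import Data.Fin using (Fin; _≟_)
open import Data.Bool using (Bool; true; false; if_then_else_)
open import Data.Maybe using (Maybe; just; nothing)
open import Data.Product using (Σ; _×_; _,_)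
open import Data.Sum using (_⊎_)
open import Data.Empty using (⊥)
open import Data.List using (List; []; _∷_; foldr; map; upTo)
open import Data.Integer using (+_)
open import Data.Rational as ℚ using (ℚ; 0ℚ; 1ℚ; _+_; _*_; 1/_; >-nonZero)
open import Relation.Binary.PropositionalEquality using (_≡_; _≢_)
open import Relation.Nullary using (yes; no)

-- Steps are natural numbers; the edge at step i
-- is  e i : Maybe (Fin n × Fin n)  (nothing = the null edge).  A value
-- just (a , b) stands for the unordered edge {a , b}.

Steps : ℕ → Set
Steps n = ℕ → Maybe (Fin n × Fin n)

Joins : {n : ℕ} → Maybe (Fin n × Fin n) → Fin n → Fin n → Set
Joins nothing         x y = ⊥
Joins (just (a , b))  x y = (a ≡ x × b ≡ y) ⊎ (a ≡ y × b ≡ x)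

Incident : {n : ℕ} → Maybe (Fin n × Fin n) → Fin n → Set
Incident ed v = Σ _ (λ y → Joins ed v y)

other : {n : ℕ} → Maybe (Fin n × Fin n) → Fin n → Maybe (Fin n)
other nothing v = nothing
other (just (a , b)) v with a ≟ v | b ≟ v
... | yes _ | _     = just b
... | no _  | yes _ = just a
... | no _  | no _  = nothing

incidentᵇ : {n : ℕ} → Maybe (Fin n × Fin n) → Fin n → Bool
incidentᵇ ed v with other ed v
... | just _  = true
... | nothing = false

degree : {n : ℕ} → ℕ → Steps n → Fin n → ℕ
degree m e v = foldr ℕ._+_ 0 (map (λ i → if incidentᵇ (e i) v then 1 else 0) (upTo (suc m)))

-- (G , σ) is an edge-ordered graph on the vertex set Fin n, with
-- σ : E(G) → [m] one-to-one, and maximum degree Δ (i.e. every degree ≤ Δ).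
record EdgeOrdered (n m Δ : ℕ) (e : Steps n) : Set where
  field
    nullOutside : ∀ i → (i ≡ 0 ⊎ m ℕ.< i) → e i ≡ nothing
    noLoops     : ∀ i a b → e i ≡ just (a , b) → a ≢ b
    oneToOne    : ∀ i j x y → Joins (e i) x y → Joins (e j) x y → i ≡ j
    maxDegree   : ∀ v → degree m e v ℕ.≤ Δ

record PhaseCounter {n : ℕ} (e : Steps n) (φ : ℕ → Fin n → ℕ) : Set where
  field
    nondecreasing : ∀ i v → φ i v ℕ.≤ φ (suc i) v
    increment≤1   : ∀ i v → φ (suc i) v ℕ.≤ suc (φ i v)
    positiveOnT   : ∀ i v → Incident (e i) v → 1 ℕ.≤ φ i v

sumℚ : List ℚ → ℚ
sumℚ = foldr _+_ 0ℚ

powℚ : ℚ → ℕ → ℚ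
powℚ c zero    = 1ℚ
powℚ c (suc k) = c * powℚ c k

coeff : (Δ : ℕ) → .{{ℕ.NonZero Δ}} → (ε : ℚ) → 0ℚ ℚ.< ε → ℚ
coeff Δ ε 0<ε = ((+ 5) ℚ./ Δ) * (1/ ε) * (1/ ε)
  where instance
    ε≢0 : ℚ.NonZero ε
    ε≢0 = >-nonZero 0<ε

-- summand for step j in  Σ_{j ∈ T^{≤r}(v)} f^{s_j(v)-1}(e_j - v)
-- (steps outside [m] carry the null edge and contribute 0)
errTerm : {n : ℕ} → Steps n → (ℕ → Fin n → ℕ) → (ℕ → Fin n → ℚ)
        → ℕ → Fin n → ℕ → ℚ
errTerm e φ f r v j with other (e j) v
... | nothing = 0ℚ
... | just u  = if φ j v ≤ᵇ r then f (φ j u ∸ 1) u else 0ℚ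

record IsErrorFunction {n : ℕ} (m : ℕ) (e : Steps n) (φ : ℕ → Fin n → ℕ)
                       (ζ c : ℚ) (f : ℕ → Fin n → ℚ) : Set where
  field
    atZero : ∀ v → f 0 v ≡ 0ℚ
    atSuc  : ∀ r v → f (suc r) v ≡
             ζ + c * sumℚ (map (errTerm e φ f (suc r) v) (upTo (suc m)))

-- Valid paths, represented by their list of steps (i₁ , … , i_t).

-- continuation of a path currently at vertex x, having arrived via step i
data ValidTail {n : ℕ} (e : Steps n) (φ : ℕ → Fin n → ℕ)
               : Fin n → ℕ → List ℕ → Set where
  done : ∀ {x i} → ValidTail e φ x i []
  step : ∀ {x y i j is} → Joins (e j) x y → φ j x ℕ.< φ i x
       → ValidTail e φ y j is → ValidTail e φ x i (j ∷ is)

data ValidPath {n : ℕ} (e : Steps n) (φ : ℕ → Fin n → ℕ) (r : ℕ) (v : Fin n)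
               : List ℕ → Set where
  empty : ValidPath e φ r v []
  first : ∀ {y i is} → Joins (e i) v y → φ i v ℕ.≤ r
        → ValidTail e φ y i is → ValidPath e φ r v (i ∷ is)

{-# OPTIONS --safe #-}
-- Weight a list L of paths by c^(length P), and split off the first step: the
-- paths of L starting with step j contribute c times the weight of their
-- continuations, and the empty path contributes 1.  Unfolding
-- ε̂^r(v) = ζ + c Σ_j ε̂^(s_j - 1)(u_j), every valid path from u_j of phase at
-- most s_j - 1, prefixed with j, is a valid path from v, so the continuations
-- after j in L cover those paths.  Removing the empty path makes these lists
-- shorter than L, so induction on the length of L gives
-- ε̂^r(v) ≤ ζ (1 + c Σ_j weight(continuations after j)) ≤ ζ weight(L).
module Submission where

open import Defs
open import Data.Nat as ℕ using (ℕ; zero; suc; _∸_; _≤ᵇ_; s≤s)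
open import Data.Nat.Properties as ℕ using ()
open import Data.Nat.Induction using (<-wellFounded)
open import Data.Fin using (Fin)
open import Data.Bool using (true; false; T)
open import Data.Maybe using (just; nothing)
open import Data.Product using (_,_)
open import Data.Sum using (inj₁; inj₂)
open import Data.Empty using (⊥-elim)
open import Data.List using (List; []; _∷_; map; length; upTo)
open import Data.List.Membership.Propositional using (_∈_)
open import Data.List.Relation.Unary.Any using (here; there)
open import Data.List.Relation.Unary.All using (All; []; _∷_)
open import Data.List.Relation.Unary.AllPairs using ([]; _∷_)
open import Data.List.Relation.Unary.Unique.Propositional using (Unique)
open import Data.List.Relation.Unary.Unique.Propositional.Properties using (upTo⁺)
open import Data.Rational as ℚ using (ℚ; 0ℚ; 1ℚ; _+_; _*_; _<_; _≤_; 1/_)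
open import Data.Rational.Properties
open import Algebra.Properties.CommutativeSemigroup as CommSemigroupProperties using ()
open import Algebra.Bundles using (CommutativeMonoid)
open import Function.Bundles using (_⇔_; Equivalence)
open import Induction.WellFounded using (Acc; acc)
open import Relation.Nullary using (yes; no)
open import Relation.Binary.PropositionalEquality

open CommSemigroupProperties (CommutativeMonoid.commutativeSemigroup +-0-commutativeMonoid)
  using () renaming (x∙yz≈y∙xz to +-exchange)
open CommSemigroupProperties (CommutativeMonoid.commutativeSemigroup *-1-commutativeMonoid)
  using () renaming (x∙yz≈y∙xz to *-exchange)

*-nonNeg : ∀ {p q} → 0ℚ ≤ p → 0ℚ ≤ q → 0ℚ ≤ p * q
*-nonNeg {p} {q} 0≤p 0≤q =
  nonNegative⁻¹ _ {{nonNeg*nonNeg⇒nonNeg p {{ℚ.nonNegative 0≤p}} q {{ℚ.nonNegative 0≤q}}}}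

*-monoˡ-≤-of-0≤ : ∀ {a p q} → 0ℚ ≤ a → p ≤ q → a * p ≤ a * q
*-monoˡ-≤-of-0≤ {a} 0≤a = *-monoˡ-≤-nonNeg a {{ℚ.nonNegative 0≤a}}

0≤1 : 0ℚ ≤ 1ℚ
0≤1 = <⇒≤ (positive⁻¹ 1ℚ)

powℚ-nonNeg : ∀ {c} → 0ℚ ≤ c → ∀ k → 0ℚ ≤ powℚ c k
powℚ-nonNeg 0≤c zero    = 0≤1
powℚ-nonNeg 0≤c (suc k) = *-nonNeg 0≤c (powℚ-nonNeg 0≤c k)

coeff-nonNeg : ∀ Δ .{{_ : ℕ.NonZero Δ}} ε (0<ε : 0ℚ < ε) → 0ℚ ≤ coeff Δ ε 0<ε
coeff-nonNeg Δ ε 0<ε = *-nonNeg (*-nonNeg 0≤5/Δ 0≤1/ε) 0≤1/ε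
  where
  instance
    ε≢0 : ℚ.NonZero ε
    ε≢0 = ℚ.>-nonZero 0<ε
  0≤5/Δ : 0ℚ ≤ ℚ.normalize 5 Δ
  0≤5/Δ = nonNegative⁻¹ _ {{normalize-nonNeg 5 Δ}}
  0≤1/ε : 0ℚ ≤ 1/ ε
  0≤1/ε = <⇒≤ (positive⁻¹ _ {{1/pos⇒pos ε {{ℚ.positive 0<ε}}}})

sumℚ-mono-≤ : ∀ {A : Set} {g h : A → ℚ} → (∀ x → g x ≤ h x) →
              ∀ xs → sumℚ (map g xs) ≤ sumℚ (map h xs)
sumℚ-mono-≤ g≤h []       = ≤-refl
sumℚ-mono-≤ g≤h (x ∷ xs) = +-mono-≤ (g≤h x) (sumℚ-mono-≤ g≤h xs)

sumℚ-*-distribˡ : ∀ {A : Set} a (g : A → ℚ) xs →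
                  sumℚ (map (λ x → a * g x) xs) ≡ a * sumℚ (map g xs)
sumℚ-*-distribˡ a g []       = sym (*-zeroʳ a)
sumℚ-*-distribˡ a g (x ∷ xs) = begin
  a * g x + sumℚ (map (λ x → a * g x) xs) ≡⟨ cong (a * g x +_) (sumℚ-*-distribˡ a g xs) ⟩
  a * g x + a * sumℚ (map g xs)           ≡⟨ *-distribˡ-+ a (g x) _ ⟨
  a * (g x + sumℚ (map g xs))             ∎
  where open ≡-Reasoning

module PathWeights (c : ℚ) (0≤c : 0ℚ ≤ c) where

  weight : List ℕ → ℚ
  weight P = powℚ c (length P)

  totalWeight : List (List ℕ) → ℚ
  totalWeight L = sumℚ (map weight L)

  continuations : ℕ → List (List ℕ) → List (List ℕ)
  continuations j []             = []
  continuations j ([] ∷ L)       = continuations j L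
  continuations j ((i ∷ P) ∷ L) with i ℕ.≟ j
  ... | yes _ = P ∷ continuations j L
  ... | no _  = continuations j L

  continuationWeight : List ℕ → List (List ℕ) → ℚ
  continuationWeight J L = sumℚ (map (λ j → totalWeight (continuations j L)) J)

  emptyCount : List (List ℕ) → ℚ
  emptyCount []            = 0ℚ
  emptyCount ([] ∷ L)      = 1ℚ + emptyCount L
  emptyCount ((_ ∷ _) ∷ L) = emptyCount L

  totalWeight-nonNeg : ∀ L → 0ℚ ≤ totalWeight L
  totalWeight-nonNeg []      = ≤-refl
  totalWeight-nonNeg (P ∷ L) = +-mono-≤ (powℚ-nonNeg 0≤c (length P)) (totalWeight-nonNeg L)

  emptyCount-nonNeg : ∀ L → 0ℚ ≤ emptyCount L
  emptyCount-nonNeg []            = ≤-refl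
  emptyCount-nonNeg ([] ∷ L)      = +-mono-≤ 0≤1 (emptyCount-nonNeg L)
  emptyCount-nonNeg ((_ ∷ _) ∷ L) = emptyCount-nonNeg L

  []∈⇒1≤emptyCount : ∀ {L} → [] ∈ L → 1ℚ ≤ emptyCount L
  []∈⇒1≤emptyCount {[] ∷ L}      _         = begin
    1ℚ                ≡⟨ +-identityʳ 1ℚ ⟨
    1ℚ + 0ℚ           ≤⟨ +-monoʳ-≤ 1ℚ (emptyCount-nonNeg L) ⟩
    1ℚ + emptyCount L ∎
    where open ≤-Reasoning
  []∈⇒1≤emptyCount {(_ ∷ _) ∷ L} (there p) = []∈⇒1≤emptyCount p

  continuationWeight-[] : ∀ J → continuationWeight J [] ≡ 0ℚ
  continuationWeight-[] []      = refl
  continuationWeight-[] (j ∷ J) = cong (0ℚ +_) (continuationWeight-[] J)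

  continuationWeight-∷-∉ : ∀ i P L {J} → All (i ≢_) J →
                           continuationWeight J ((i ∷ P) ∷ L) ≡ continuationWeight J L
  continuationWeight-∷-∉ i P L {[]}    []            = refl
  continuationWeight-∷-∉ i P L {j ∷ J} (i≢j ∷ i∉J) with i ℕ.≟ j
  ... | yes i≡j = ⊥-elim (i≢j i≡j)
  ... | no _    = cong (totalWeight (continuations j L) +_) (continuationWeight-∷-∉ i P L i∉J)

  continuationWeight-∷-≤ : ∀ i P L {J} → Unique J →
                           continuationWeight J ((i ∷ P) ∷ L) ≤ weight P + continuationWeight J L
  continuationWeight-∷-≤ i P L {[]}    []          = +-monoˡ-≤ 0ℚ (powℚ-nonNeg 0≤c (length P))
  continuationWeight-∷-≤ i P L {j ∷ J} (i∉J ∷ uJ) with i ℕ.≟ j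
  ... | yes refl = ≤-reflexive (begin
    (weight P + totalWeight (continuations j L)) + continuationWeight J ((i ∷ P) ∷ L)
      ≡⟨ cong (weight P + totalWeight (continuations j L) +_) (continuationWeight-∷-∉ i P L i∉J) ⟩
    (weight P + totalWeight (continuations j L)) + continuationWeight J L
      ≡⟨ +-assoc (weight P) _ _ ⟩
    weight P + (totalWeight (continuations j L) + continuationWeight J L) ∎)
    where open ≡-Reasoning
  ... | no _     = begin
    totalWeight (continuations j L) + continuationWeight J ((i ∷ P) ∷ L)
      ≤⟨ +-monoʳ-≤ (totalWeight (continuations j L)) (continuationWeight-∷-≤ i P L uJ) ⟩
    totalWeight (continuations j L) + (weight P + continuationWeight J L)
      ≡⟨ +-exchange (totalWeight (continuations j L)) (weight P) _ ⟩
    weight P + (totalWeight (continuations j L) + continuationWeight J L) ∎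
    where open ≤-Reasoning

  emptyCount+continuationWeight≤totalWeight :
    ∀ {J} → Unique J → ∀ L → emptyCount L + c * continuationWeight J L ≤ totalWeight L
  emptyCount+continuationWeight≤totalWeight {J} uJ []
    rewrite continuationWeight-[] J | *-zeroʳ c = ≤-refl
  emptyCount+continuationWeight≤totalWeight {J} uJ ([] ∷ L) = begin
    (1ℚ + emptyCount L) + c * continuationWeight J L ≡⟨ +-assoc 1ℚ (emptyCount L) _ ⟩
    1ℚ + (emptyCount L + c * continuationWeight J L) ≤⟨ +-monoʳ-≤ 1ℚ (emptyCount+continuationWeight≤totalWeight uJ L) ⟩
    1ℚ + totalWeight L                                ∎
    where open ≤-Reasoning
  emptyCount+continuationWeight≤totalWeight {J} uJ ((i ∷ P) ∷ L) = begin
    emptyCount L + c * continuationWeight J ((i ∷ P) ∷ L)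
      ≤⟨ +-monoʳ-≤ (emptyCount L) (*-monoˡ-≤-of-0≤ 0≤c (continuationWeight-∷-≤ i P L uJ)) ⟩
    emptyCount L + c * (weight P + continuationWeight J L)
      ≡⟨ cong (emptyCount L +_) (*-distribˡ-+ c (weight P) _) ⟩
    emptyCount L + (c * weight P + c * continuationWeight J L)
      ≡⟨ +-exchange (emptyCount L) (c * weight P) _ ⟩
    c * weight P + (emptyCount L + c * continuationWeight J L)
      ≤⟨ +-monoʳ-≤ (c * weight P) (emptyCount+continuationWeight≤totalWeight uJ L) ⟩
    c * weight P + totalWeight L ∎
    where open ≤-Reasoning

  1+continuationWeight≤totalWeight :
    ∀ {J L} → Unique J → [] ∈ L → 1ℚ + c * continuationWeight J L ≤ totalWeight L
  1+continuationWeight≤totalWeight {J} {L} uJ []∈L =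
    ≤-trans (+-monoˡ-≤ (c * continuationWeight J L) ([]∈⇒1≤emptyCount []∈L))
            (emptyCount+continuationWeight≤totalWeight uJ L)

  ∈-continuations : ∀ {j P L} → (j ∷ P) ∈ L → P ∈ continuations j L
  ∈-continuations {j} {L = (i ∷ Q) ∷ L} j∷P∈ with i ℕ.≟ j | j∷P∈
  ... | yes _   | here refl = here refl
  ... | yes _   | there p   = there (∈-continuations p)
  ... | no i≢j  | here refl = ⊥-elim (i≢j refl)
  ... | no _    | there p   = ∈-continuations p
  ∈-continuations {L = [] ∷ L} (there p) = ∈-continuations p

  length-continuations≤ : ∀ j L → length (continuations j L) ℕ.≤ length L
  length-continuations≤ j []            = ℕ.z≤n
  length-continuations≤ j ([] ∷ L)      = ℕ.m≤n⇒m≤1+n (length-continuations≤ j L)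
  length-continuations≤ j ((i ∷ P) ∷ L) with i ℕ.≟ j
  ... | yes _ = s≤s (length-continuations≤ j L)
  ... | no _  = ℕ.m≤n⇒m≤1+n (length-continuations≤ j L)

  length-continuations< : ∀ j {L} → [] ∈ L → length (continuations j L) ℕ.< length L
  length-continuations< j {[] ∷ L}      _         = s≤s (length-continuations≤ j L)
  length-continuations< j {(i ∷ P) ∷ L} (there p) with i ℕ.≟ j
  ... | yes _ = s≤s (length-continuations< j p)
  ... | no _  = ℕ.m≤n⇒m≤1+n (length-continuations< j p)

other⇒Joins : ∀ {n} ed {v u : Fin n} → other ed v ≡ just u → Joins ed v u
other⇒Joins (just (a , b)) {v} eq with a Data.Fin.≟ v | b Data.Fin.≟ v
other⇒Joins (just (a , b)) refl | yes a≡v | _       = inj₁ (a≡v , refl)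
other⇒Joins (just (a , b)) refl | no _    | yes b≡v = inj₂ (refl , b≡v)

Joins-sym : ∀ {n} ed {x y : Fin n} → Joins ed x y → Joins ed y x
Joins-sym (just _) (inj₁ p) = inj₂ p
Joins-sym (just _) (inj₂ p) = inj₁ p

≤∸1⇒< : ∀ {a b} → 1 ℕ.≤ b → a ℕ.≤ b ∸ 1 → a ℕ.< b
≤∸1⇒< {b = suc b} _ a≤b = s≤s a≤b

∷-ValidPath : ∀ {n} {e : Steps n} {φ} → PhaseCounter e φ →
              ∀ {r j v u P} → Joins (e j) v u → φ j v ℕ.≤ r →
              ValidPath e φ (φ j u ∸ 1) u P → ValidPath e φ r v (j ∷ P)
∷-ValidPath {e = e} {φ} pc {r} {j} {v} {u} jvu φjv≤r P-valid = first jvu φjv≤r (toTail P-valid)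
  where
  1≤φju : 1 ℕ.≤ φ j u
  1≤φju = PhaseCounter.positiveOnT pc j u (v , Joins-sym (e j) jvu)
  toTail : ∀ {P} → ValidPath e φ (φ j u ∸ 1) u P → ValidTail e φ u j P
  toTail empty                 = done
  toTail (first ujy φiu≤ tail) = step ujy (≤∸1⇒< 1≤φju φiu≤) tail

module ErrorBound {c ζ : ℚ} (0≤c : 0ℚ ≤ c) (0≤ζ : 0ℚ ≤ ζ)
                  {n m : ℕ} {e : Steps n} {φ : ℕ → Fin n → ℕ} (pc : PhaseCounter e φ)
                  {f : ℕ → Fin n → ℚ} (isf : IsErrorFunction m e φ ζ c f) where

  open PathWeights c 0≤c
  open IsErrorFunction isf

  Covers : ℕ → Fin n → List (List ℕ) → Set
  Covers r v L = ∀ P → ValidPath e φ r v P → P ∈ L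

  covers-continuations : ∀ {r j v u L} → Covers r v L → Joins (e j) v u → φ j v ℕ.≤ r →
                         Covers (φ j u ∸ 1) u (continuations j L)
  covers-continuations L-covers jvu φjv≤r P P-valid =
    ∈-continuations (L-covers _ (∷-ValidPath pc jvu φjv≤r P-valid))

  errTerm≤ : ∀ {r v L} → Covers r v L →
             (∀ {r′ u L′} → length L′ ℕ.< length L → Covers r′ u L′ → f r′ u ≤ ζ * totalWeight L′) →
             ∀ j → errTerm e φ f r v j ≤ ζ * totalWeight (continuations j L)
  errTerm≤ {r} {v} {L} L-covers ih j with other (e j) v in other≡u
  ... | nothing = *-nonNeg 0≤ζ (totalWeight-nonNeg (continuations j L))
  ... | just u with φ j v ≤ᵇ r in φjv≤ᵇr
  ...   | false = *-nonNeg 0≤ζ (totalWeight-nonNeg (continuations j L))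
  ...   | true  = ih (length-continuations< j (L-covers [] empty))
                     (covers-continuations L-covers (other⇒Joins (e j) other≡u) φjv≤r)
    where
    φjv≤r : φ j v ℕ.≤ r
    φjv≤r = ℕ.≤ᵇ⇒≤ (φ j v) r (subst T (sym φjv≤ᵇr) _)

  error≤ : ∀ {r v L} → Acc ℕ._<_ (length L) → Covers r v L → f r v ≤ ζ * totalWeight L
  error≤ {zero}  {v} {L} _ _ rewrite atZero v = *-nonNeg 0≤ζ (totalWeight-nonNeg L)
  error≤ {suc r} {v} {L} (acc shorter) L-covers = begin
    f (suc r) v
      ≡⟨ atSuc r v ⟩
    ζ + c * sumℚ (map (errTerm e φ f (suc r) v) steps)
      ≤⟨ +-monoʳ-≤ ζ (*-monoˡ-≤-of-0≤ 0≤c (sumℚ-mono-≤ (errTerm≤ L-covers ih) steps)) ⟩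
    ζ + c * sumℚ (map (λ j → ζ * totalWeight (continuations j L)) steps)
      ≡⟨ cong (λ x → ζ + c * x) (sumℚ-*-distribˡ ζ (λ j → totalWeight (continuations j L)) steps) ⟩
    ζ + c * (ζ * continuationWeight steps L)
      ≡⟨ cong₂ _+_ (*-identityʳ ζ) (*-exchange ζ c _) ⟨
    ζ * 1ℚ + ζ * (c * continuationWeight steps L)
      ≡⟨ *-distribˡ-+ ζ 1ℚ _ ⟨
    ζ * (1ℚ + c * continuationWeight steps L)
      ≤⟨ *-monoˡ-≤-of-0≤ 0≤ζ (1+continuationWeight≤totalWeight (upTo⁺ (suc m)) (L-covers [] empty)) ⟩
    ζ * totalWeight L ∎
    where
    open ≤-Reasoning
    steps : List ℕ
    steps = upTo (suc m)
    ih : ∀ {r′ u L′} → length L′ ℕ.< length L → Covers r′ u L′ → f r′ u ≤ ζ * totalWeight L′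
    ih L′<L = error≤ (shorter L′<L)

-- Only the inclusion 𝒫^r(v) ⊆ L is used: since all weights are nonnegative, the
-- bound holds for any list covering the valid paths, with or without repetitions.
mainTheorem5 : (ε ζ : ℚ) (Δ : ℕ) .{{_ : ℕ.NonZero Δ}}
    → (0<ε : 0ℚ < ε) → ε < 1ℚ → 0ℚ < ζ
    → (n m : ℕ) (e : Steps n) → EdgeOrdered n m Δ e
    → (φ : ℕ → Fin n → ℕ) → PhaseCounter e φ
    → (f : ℕ → Fin n → ℚ) → IsErrorFunction m e φ ζ (coeff Δ ε 0<ε) f
    → (v : Fin n) (r : ℕ)
    → (L : List (List ℕ)) → Unique L → (∀ P → ValidPath e φ r v P ⇔ P ∈ L)
    → f r v ≤ ζ * sumℚ (map (λ P → powℚ (coeff Δ ε 0<ε) (length P)) L)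
mainTheorem5 ε ζ Δ 0<ε _ 0<ζ n m e _ φ pc f isf v r L _ 𝒫≡L =
  ErrorBound.error≤ (coeff-nonNeg Δ ε 0<ε) (<⇒≤ 0<ζ) pc isf
    (<-wellFounded (length L)) (λ P → Equivalence.to (𝒫≡L P))
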